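{- Let $\lambda$ be an MAT-labeling of a finite simple graph $G$ and let $F\subseteq E_G$. Then the restriction $\lambda|_F$ is an MAT-labeling of the subgraph $G_F=(V_G,F)$ if and only if $\lambda|_F$ satisfies condition (ML3) (for the graph $G_F$).
   Context: For a finite simple graph $G$ and map $\lambda:E_G\to\mathbb{Z}_{>0}$, put $\pi_k=\lambda^{ -1}(k)$, $E_k=\pi_1\sqcup\dots\sqcup\pi_k$, $E_0=\varnothing$. For $F\subseteq E_G$, $\operatorname{cl}(F)$ is the set of edges of $G$ whose two endvertices are joined by a path of edges in $F$. $\lambda$ is an MAT-labeling of $G$ if for every $k\in\mathbb{Z}_{>0}$: (ML1) $\pi_k$ is a forest; (ML2) $\operatorname{cl}(\pi_k)\cap E_{k-1}=\varnothing$; (ML3) every edge $\{u,v\}\in\pi_k$ forms exactly $k-1$ triangles with edges in $E_{k-1}$ (exactly $k-1$ vertices $w$ with $\{u,w\},\{v,w\}\in E_{k-1}$). -}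

module Defs where

open import Data.Bool using (Bool; true; false; _∧_; T)
open import Data.Bool.Properties using (T?)
open import Data.Nat using (ℕ; zero; suc; _≤_; _<_; _≤ᵇ_; _∸_)
open import Data.Fin using (Fin)
open import Data.List using (List; []; _∷_; _++_; length; filter; allFin)
open import Data.List.Relation.Unary.Linked using (Linked)
open import Data.List.Relation.Unary.Unique.Propositional using (Unique)
open import Data.Product using (_×_; Σ; ∃; _,_)
open import Relation.Binary.PropositionalEquality using (_≡_; trans; sym)
open import Relation.Binary.Construct.Closure.ReflexiveTransitive using (Star)
open import Relation.Nullary using (¬_)
open import Data.Empty using (⊥-elim)

record SimpleGraph (n : ℕ) : Set where
  field
    adj    : Fin n → Fin n → Bool
    adjSym : ∀ u v → adj u v ≡ adj v u
    irrefl : ∀ u → adj u u ≡ false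
open SimpleGraph public

record EdgeSubset {n : ℕ} (G : SimpleGraph n) : Set where
  field
    mem    : Fin n → Fin n → Bool
    memSym : ∀ u v → mem u v ≡ mem v u
    sub    : ∀ u v → mem u v ≡ true → adj G u v ≡ true
open EdgeSubset public

private
  irrSub : ∀ {n} (G : SimpleGraph n) (F : EdgeSubset G) (u : Fin n) →
           (b : Bool) → mem F u u ≡ b → mem F u u ≡ false
  irrSub G F u false eq = eq
  irrSub G F u true  eq with trans (sym (sub F u u eq)) (irrefl G u)
  ... | ()

subgraph : ∀ {n} (G : SimpleGraph n) → EdgeSubset G → SimpleGraph n
subgraph G F = record
  { adj    = mem F
  ; adjSym = memSym F
  ; irrefl = λ u → irrSub G F u (mem F u u) Relation.Binary.PropositionalEquality.refl }

-- A map λ : E_H → ℤ_{>0} is represented by a function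
-- lab : Fin n → Fin n → ℕ whose values on edges are symmetric and positive
-- (values on non-edges are irrelevant).  The restriction λ|_F is the same
-- function regarded as a labeling of G_F.

IsLabeling : ∀ {n} → SimpleGraph n → (Fin n → Fin n → ℕ) → Set
IsLabeling H lab =
  (∀ u v → adj H u v ≡ true → lab u v ≡ lab v u) ×
  (∀ u v → adj H u v ≡ true → 1 ≤ lab u v)

π : ∀ {n} → SimpleGraph n → (Fin n → Fin n → ℕ) → ℕ → Fin n → Fin n → Set
π H lab k u v = adj H u v ≡ true × lab u v ≡ k

-- E_j = π_1 ⊔ … ⊔ π_j  (labels are positive, so this is "label ≤ j");
-- Boolean version used for counting.
inEᵇ : ∀ {n} → SimpleGraph n → (Fin n → Fin n → ℕ) → ℕ → Fin n → Fin n → Bool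
inEᵇ H lab j u v = adj H u v ∧ (lab u v ≤ᵇ j)

Cycle : ∀ {n} → (Fin n → Fin n → Set) → Set
Cycle {n} R =
  Σ (Fin n) λ a → Σ (Fin n) λ b → Σ (Fin n) λ c → Σ (List (Fin n)) λ rest →
    Unique (a ∷ b ∷ c ∷ rest) × Linked R (a ∷ b ∷ c ∷ rest ++ a ∷ [])

IsForest : ∀ {n} → (Fin n → Fin n → Set) → Set
IsForest R = ¬ Cycle R

triangles : ∀ {n} → SimpleGraph n → (Fin n → Fin n → ℕ) → ℕ → Fin n → Fin n → ℕ
triangles {n} H lab j u v =
  length (filter (λ w → T? (inEᵇ H lab j u w ∧ inEᵇ H lab j v w)) (allFin n))

ML1 : ∀ {n} → SimpleGraph n → (Fin n → Fin n → ℕ) → ℕ → Set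
ML1 H lab k = IsForest (π H lab k)

-- cl(π_k) ∩ E_{k-1} = ∅ : no edge of H whose endpoints are joined by a
-- path in π_k has label in {1,…,k-1}.
ML2 : ∀ {n} → SimpleGraph n → (Fin n → Fin n → ℕ) → ℕ → Set
ML2 H lab k = ∀ u v → adj H u v ≡ true → Star (π H lab k) u v → ¬ (lab u v < k)

ML3 : ∀ {n} → SimpleGraph n → (Fin n → Fin n → ℕ) → ℕ → Set
ML3 H lab k = ∀ u v → π H lab k u v → triangles H lab (k ∸ 1) u v ≡ k ∸ 1

SatisfiesML3 : ∀ {n} → SimpleGraph n → (Fin n → Fin n → ℕ) → Set
SatisfiesML3 H lab = ∀ k → 1 ≤ k → ML3 H lab k

IsMATLabeling : ∀ {n} → SimpleGraph n → (Fin n → Fin n → ℕ) → Set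
IsMATLabeling H lab =
  IsLabeling H lab ×
  (∀ k → 1 ≤ k → ML1 H lab k × ML2 H lab k × ML3 H lab k)

module Submission where

open import Defs
open import Data.Bool using (true)
open import Data.Nat using (ℕ)
open import Data.Fin using (Fin)
open import Data.Product using (_×_; _,_; proj₁; proj₂)
open import Relation.Binary.Core using (_⇒_)
open import Relation.Binary.PropositionalEquality using (_≡_)
import Data.List.Relation.Unary.Linked as Linked
import Relation.Binary.Construct.Closure.ReflexiveTransitive as Star

-- (ML1) and (ML2) only forbid configurations of edges, so they pass to every
-- subgraph carrying the same labels; (ML3) counts triangles and does not.

_⊆ᴱ_ : ∀ {n} → SimpleGraph n → SimpleGraph n → Set
H ⊆ᴱ G = ∀ u v → adj H u v ≡ true → adj G u v ≡ true

subgraph-⊆ᴱ : ∀ {n} (G : SimpleGraph n) (F : EdgeSubset G) → subgraph G F ⊆ᴱ G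
subgraph-⊆ᴱ G F = sub F

isForest-anti : ∀ {n} {R S : Fin n → Fin n → Set} → R ⇒ S → IsForest S → IsForest R
isForest-anti R⇒S acyclic (a , b , c , rest , unique , linked) =
  acyclic (a , b , c , rest , unique , Linked.map R⇒S linked)

module _ {n} {H G : SimpleGraph n} (H⊆G : H ⊆ᴱ G) (lab : Fin n → Fin n → ℕ) where

  π-mono : ∀ k → π H lab k ⇒ π G lab k
  π-mono k {u} {v} (e , eq) = H⊆G u v e , eq

  isLabeling-anti : IsLabeling G lab → IsLabeling H lab
  isLabeling-anti (symmetric , positive) =
    (λ u v e → symmetric u v (H⊆G u v e)) , (λ u v e → positive u v (H⊆G u v e))

  ML1-anti : ∀ k → ML1 G lab k → ML1 H lab k
  ML1-anti k = isForest-anti (π-mono k)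

  ML2-anti : ∀ k → ML2 G lab k → ML2 H lab k
  ML2-anti k ml2 u v e path = ml2 u v (H⊆G u v e) (Star.map (π-mono k) path)

  isMATLabeling-anti : IsMATLabeling G lab → SatisfiesML3 H lab →
                       IsMATLabeling H lab
  isMATLabeling-anti (isLab , ml) ml3 =
    isLabeling-anti isLab ,
    λ k k≥1 → ML1-anti k (proj₁ (ml k k≥1)) ,
              ML2-anti k (proj₁ (proj₂ (ml k k≥1))) ,
              ml3 k k≥1

isMATLabeling⇒ML3 : ∀ {n} (H : SimpleGraph n) (lab : Fin n → Fin n → ℕ) →
                    IsMATLabeling H lab → SatisfiesML3 H lab
isMATLabeling⇒ML3 H lab (_ , ml) k k≥1 = proj₂ (proj₂ (ml k k≥1))

proposition4p6 : ∀ {n} (G : SimpleGraph n) (lab : Fin n → Fin n → ℕ) →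
    IsMATLabeling G lab → (F : EdgeSubset G) →
    (IsMATLabeling (subgraph G F) lab → SatisfiesML3 (subgraph G F) lab) ×
    (SatisfiesML3 (subgraph G F) lab → IsMATLabeling (subgraph G F) lab)
proposition4p6 G lab mat F =
  isMATLabeling⇒ML3 (subgraph G F) lab ,
  isMATLabeling-anti {H = subgraph G F} {G} (subgraph-⊆ᴱ G F) lab mat
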